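{- Let $D$ be a series-parallel digraph with a fixed binary decomposition tree and let $\mathbf P^*$ be a fixed optimal path profile for Min-Max Disjoint Paths on $D$. Let $D'\sqsubseteq D$ be the subgraph corresponding to the root vertex of an $S$-component (resp. a $P$-component), and let $D^{(1)},\dots,D^{(i)}$ be the subgraphs corresponding to the children of that component. For each $j\in[i]$ let $\mathbf P^{(j)}$ be a path profile of $D^{(j)}$ that is consistent and $\phi$-bounded in $D^{(j)}$. Then the greedy series (resp. parallel) composition $\mathbf P$ of $\mathbf P^{(1)},\dots,\mathbf P^{(i)}$ (performed according to the decomposition tree within the component) is a consistent and $\phi$-bounded path profile in $D'$.
   Context: Min-Max Disjoint Paths: given a digraph $D=(V,A)$ with source $s$, sink $t$, travel times $\tau:A\to\mathbb{Z}_{\ge0}$ and integer $k$, find $k$ pairwise arc-disjoint $s$-$t$-paths (a path profile) minimizing the maximum path length. A series-parallel digraph is a single arc or a series composition (sink of the first identified with source of the second) or parallel composition (sources identified, sinks identified) of two series-parallel digraphs; a binary decomposition tree has leaves = arcs and internal vertices labeled $S$ or $P$. An $S$-component ($P$-component) is a maximal connected set of tree vertices labeled $S$ ($P$); its root is its vertex closest to the tree root, its children are the tree vertices not in the component whose parents are in it. $D'\sqsubseteq D$ means $D'$ is the subgraph for a tree vertex. $\phi(D')$ is the maximum number of $S$-components traversed on a root-to-leaf path of the subtree for $D'$. For a path profile $\mathbf P$ and $D'\sqsubseteq D$: $\tau(P,D')=\sum_{a\in P\cap A(D')}\tau_a$, $C_{\max}(\mathbf P,D')=\max_{P}\tau(P,D')$,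 $\theta(\mathbf P,D')=\sum_P\tau(P,D')$. $\mathbf P$ is consistent in $D'$ if it uses the same number of paths in $D'$ as $\mathbf P^*$ and $\theta(\mathbf P,D')\le\theta(\mathbf P^*,D')$; it is $\phi$-bounded in $D'$ if $C_{\max}(\mathbf P,D')\le(\phi(D')+1)\cdot C_{\max}(\mathbf P^*,D)$. Greedy composition: series composition of two profiles with equally many paths pairs the longest path of the first with the shortest of the second, the second-longest with the second-shortest, etc.; parallel composition takes the union. -}

module Defs where

open import Data.Nat using (ℕ; zero; suc; _+_; _*_; _≤_; _⊔_; _≤ᵇ_)
open import Data.Bool using (Bool; true; false; if_then_else_)
open import Data.Nat.ListAction using (sum)
open import Data.List using (List; []; _∷_; _++_; map; length; foldr; reverse; zipWith; mapMaybe)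
open import Data.List.Relation.Unary.AllPairs using (AllPairs)
open import Data.Maybe using (Maybe; just; nothing) renaming (map to mmap; _>>=_ to _m>>=_)
open import Data.Product using (_×_)
open import Data.Unit using (⊤)
open import Data.Empty using (⊥)
open import Relation.Binary.PropositionalEquality using (_≡_)

-- Binary decomposition trees of series-parallel digraphs.
-- A leaf is an arc, labelled with its travel time τ_a ∈ ℕ.
-- S l r : series composition (sink of l identified with source of r)
-- P l r : parallel composition
data SP : Set where
  leaf : ℕ → SP
  S    : SP → SP → SP
  P    : SP → SP → SP

-- s-t paths of the series-parallel digraph given by a decomposition tree.
-- (In a series-parallel digraph an s-t path of S l r is an s-t path of l
-- followed by one of r; an s-t path of P l r is an s-t path of l or of r.)
data Path : SP → Set where
  take  : ∀ {τ} → Path (leaf τ)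
  seq   : ∀ {l r} → Path l → Path r → Path (S l r)
  left  : ∀ {l r} → Path l → Path (P l r)
  right : ∀ {l r} → Path r → Path (P l r)

len : ∀ {t} → Path t → ℕ
len {leaf τ} take = τ
len (seq p q) = len p + len q
len (left p)  = len p
len (right q) = len q

Disjoint : ∀ {t} → Path t → Path t → Set
Disjoint take take = ⊥
Disjoint (seq p q) (seq p' q') = Disjoint p p' × Disjoint q q'
Disjoint (left p)  (left p')  = Disjoint p p'
Disjoint (left _)  (right _)  = ⊤
Disjoint (right _) (left _)   = ⊤
Disjoint (right q) (right q') = Disjoint q q'

IsProfile : ∀ {t} → List (Path t) → Set
IsProfile Ps = AllPairs Disjoint Ps

Cmax : ∀ {t} → List (Path t) → ℕ
Cmax Ps = foldr _⊔_ 0 (map len Ps)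

θ : ∀ {t} → List (Path t) → ℕ
θ Ps = sum (map len Ps)

Optimal : (D : SP) → ℕ → List (Path D) → Set
Optimal D k Ps = IsProfile Ps × length Ps ≡ k
  × (∀ (Qs : List (Path D)) → IsProfile Qs → length Qs ≡ k → Cmax Ps ≤ Cmax Qs)

-- Vertices of the decomposition tree of D: Pos D t is a position in the
-- tree of D whose subtree is t (i.e. a subgraph t ⊑ D).  The outermost
-- constructor records the step from the parent.
data Pos (D : SP) : SP → Set where
  root : Pos D D
  sL : ∀ {l r} → Pos D (S l r) → Pos D l
  sR : ∀ {l r} → Pos D (S l r) → Pos D r
  pL : ∀ {l r} → Pos D (P l r) → Pos D l
  pR : ∀ {l r} → Pos D (P l r) → Pos D r

fstS : ∀ {l r} → Path (S l r) → Path l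
fstS (seq p q) = p
sndS : ∀ {l r} → Path (S l r) → Path r
sndS (seq p q) = q
fstP : ∀ {l r} → Path (P l r) → Maybe (Path l)
fstP (left p)  = just p
fstP (right _) = nothing
sndP : ∀ {l r} → Path (P l r) → Maybe (Path r)
sndP (left _)  = nothing
sndP (right q) = just q

-- P ∩ A(D') : the restriction of an s-t path of D to the subgraph D'
-- (nothing if the path does not use D')
restrict : ∀ {D t} → Pos D t → Path D → Maybe (Path t)
restrict root p = just p
restrict (sL q) p = mmap fstS (restrict q p)
restrict (sR q) p = mmap sndS (restrict q p)
restrict (pL q) p = restrict q p m>>= fstP
restrict (pR q) p = restrict q p m>>= sndP

restrictProfile : ∀ {D t} → Pos D t → List (Path D) → List (Path t)
restrictProfile q Ps = mapMaybe (restrict q) Ps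

-- φ(D'): maximum number of S-components traversed on a root-to-leaf path
-- of the subtree.  The flag says whether the parent vertex is labelled S.
φ' : Bool → SP → ℕ
φ' _ (leaf _) = 0
φ' true  (S l r) = φ' true l ⊔ φ' true r
φ' false (S l r) = suc (φ' true l ⊔ φ' true r)
φ' _ (P l r) = φ' false l ⊔ φ' false r

φ : SP → ℕ
φ t = φ' false t

Consistent : ∀ {D t} → List (Path D) → Pos D t → List (Path t) → Set
Consistent Pstar q Qs =
  length Qs ≡ length (restrictProfile q Pstar) × θ Qs ≤ θ (restrictProfile q Pstar)

PhiBounded : ∀ {D t} → List (Path D) → Pos D t → List (Path t) → Set
PhiBounded {D} {t} Pstar q Qs = Cmax Qs ≤ (φ t + 1) * Cmax Pstar

insertBy : ∀ {t} → Path t → List (Path t) → List (Path t)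
insertBy p [] = p ∷ []
insertBy p (x ∷ xs) = if len p ≤ᵇ len x then p ∷ x ∷ xs else x ∷ insertBy p xs

sortAsc : ∀ {t} → List (Path t) → List (Path t)
sortAsc = foldr insertBy []

greedyS : ∀ {l r} → List (Path l) → List (Path r) → List (Path (S l r))
greedyS xs ys = zipWith seq (reverse (sortAsc xs)) (sortAsc ys)

unionP : ∀ {l r} → List (Path l) → List (Path r) → List (Path (P l r))
unionP xs ys = map left xs ++ map right ys

-- Greedy series composition over the S-component containing position q,
-- following the decomposition tree, where F gives the profiles of the
-- children of the component (vertices not labelled S).
gSer : ∀ {D t} → (∀ {u} → Pos D u → List (Path u)) → Pos D t → List (Path t)
gSer {t = S l r} F q = greedyS (gSer F (sL q)) (gSer F (sR q))
gSer {t = leaf _} F q = F q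
gSer {t = P _ _}  F q = F q

gPar : ∀ {D t} → (∀ {u} → Pos D u → List (Path u)) → Pos D t → List (Path t)
gPar {t = P l r} F q = unionP (gPar F (pL q)) (gPar F (pR q))
gPar {t = leaf _} F q = F q
gPar {t = S _ _}  F q = F q

data SRoot {D : SP} : ∀ {t} → Pos D t → Set where
  sroot-root : ∀ {l r} (e : D ≡ S l r) → SRoot {t = D} root
  sroot-pL : ∀ {b l r} (q : Pos D (P (S l r) b)) → SRoot (pL {l = S l r} {r = b} q)
  sroot-pR : ∀ {a l r} (q : Pos D (P a (S l r))) → SRoot (pR {l = a} {r = S l r} q)

data PRoot {D : SP} : ∀ {t} → Pos D t → Set where
  proot-root : ∀ {l r} (e : D ≡ P l r) → PRoot {t = D} root
  proot-sL : ∀ {b l r} (q : Pos D (S (P l r) b)) → PRoot (sL {l = P l r} {r = b} q)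
  proot-sR : ∀ {a l r} (q : Pos D (S a (P l r))) → PRoot (sR {l = a} {r = P l r} q)

data SBelow {D : SP} {t} (q : Pos D t) : ∀ {u} → Pos D u → Set where
  here : SBelow q q
  goL  : ∀ {l r} {q' : Pos D (S l r)} → SBelow q q' → SBelow q (sL q')
  goR  : ∀ {l r} {q' : Pos D (S l r)} → SBelow q q' → SBelow q (sR q')

data PBelow {D : SP} {t} (q : Pos D t) : ∀ {u} → Pos D u → Set where
  here : PBelow q q
  goL  : ∀ {l r} {q' : Pos D (P l r)} → PBelow q q' → PBelow q (pL q')
  goR  : ∀ {l r} {q' : Pos D (P l r)} → PBelow q q' → PBelow q (pR q')

NotS : SP → Set
NotS (S _ _) = ⊥
NotS _ = ⊤

NotP : SP → Set
NotP (P _ _) = ⊥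
NotP _ = ⊤

SChild : ∀ {D t u} → Pos D t → Pos D u → Set
SChild {u = u} q q' = SBelow q q' × NotS u

PChild : ∀ {D t u} → Pos D t → Pos D u → Set
PChild {u = u} q q' = PBelow q q' × NotP u

Good : ∀ {D t} → List (Path D) → Pos D t → List (Path t) → Set
Good Pstar q Qs = IsProfile Qs × Consistent Pstar q Qs × PhiBounded Pstar q Qs

{-# OPTIONS --safe #-}
-- Write C = Cmax P*.  In a P-component every path of the union is a path of some child c,
-- and φ(c) ≤ φ(D'), so the φ-bound is inherited; numbers of paths and total travel times
-- add up over the children exactly as they do for the restrictions of P*.
-- In an S-component every child c has φ(c) + 1 ≤ φ(D'), so all of its paths have length
-- at most M = φ(D')·C, and in particular any two of them differ by at most M.  Greedy
-- series composition preserves "any two lengths differ by at most M", because it adds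
-- lengths sorted in opposite orders.  At the root of the component consistency bounds the
-- average path length by C, so every path has length at most C + M = (φ(D') + 1)·C.
module Submission where

open import Defs
open import Data.Nat using (ℕ; _+_; _*_; _≤_; _⊔_; _⊓_; z≤n; s≤s)
open import Data.Nat.Properties
open import Algebra.Properties.CommutativeSemigroup +-commutativeSemigroup using (interchange; xy∙z≈xz∙y)
open import Data.Nat.ListAction using (sum)
open import Data.Nat.ListAction.Properties using (sum-++; sum-↭)
open import Data.Bool using (true)
open import Data.List using (List; []; _∷_; _++_; map; length; reverse; zipWith; mapMaybe; _ʳ++_)
open import Data.List.Properties
  using (length-map; length-++; map-++; map-∘; length-zipWith; map-mapMaybe; foldr-preservesᵇ; foldr-forcesᵇ)
open import Data.List.Membership.Propositional using (_∈_)
open import Data.List.Relation.Unary.Any using (here; there)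
open import Data.List.Relation.Unary.All as All using (All; []; _∷_)
import Data.List.Relation.Unary.All.Properties as All
open import Data.List.Relation.Unary.AllPairs as AllPairs using (AllPairs; []; _∷_)
import Data.List.Relation.Unary.AllPairs.Properties as AllPairs
open import Data.List.Relation.Unary.Sorted.TotalOrder.Properties using (Sorted⇒AllPairs)
open import Data.List.Relation.Binary.Permutation.Propositional
  using (_↭_; ↭-refl; ↭-sym; ↭-trans; prep; ↭⇒↭ₛ)
import Data.List.Relation.Binary.Permutation.Propositional.Properties as ↭
import Data.List.Relation.Binary.Permutation.Setoid.Properties as ↭ₛ
open import Data.Maybe using (Maybe; just; nothing; _>>=_)
import Data.Maybe.Relation.Unary.All as Maybe
open import Data.Product using (_×_; _,_; map₁; swap)
open import Data.Unit using (tt)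
open import Function using (_on_; flip)
open import Level using (0ℓ)
open import Relation.Binary using (Rel; Reflexive; Symmetric; DecTotalOrder)
import Relation.Binary.Construct.On as On
open import Relation.Binary.PropositionalEquality

module _ {A : Set} {R : Rel A 0ℓ} where

  AllPairs-reverse⁺ : ∀ {xs} → AllPairs (flip R) xs → AllPairs R (reverse xs)
  AllPairs-reverse⁺ {xs} Rxs = ʳ++⁺ Rxs [] (All.universal (λ _ → []) xs)
    where
    ʳ++⁺ : ∀ {xs acc} → AllPairs (flip R) xs → AllPairs R acc →
      All (λ x → All (R x) acc) xs → AllPairs R (xs ʳ++ acc)
    ʳ++⁺ [] Racc _ = Racc
    ʳ++⁺ (Rx ∷ Rxs) Racc (x∼acc ∷ xs∼acc) =
      ʳ++⁺ Rxs (x∼acc ∷ Racc) (All.zipWith (λ (r , rs) → r ∷ rs) (Rx , xs∼acc))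

  AllPairs-resp-↭ : Symmetric R → ∀ {xs ys} → xs ↭ ys → AllPairs R xs → AllPairs R ys
  AllPairs-resp-↭ sym xs↭ys = ↭ₛ.AllPairs-resp-↭ (setoid A) sym (resp₂ R) (↭⇒↭ₛ xs↭ys)

  AllPairs⇒All-∈ : Reflexive R → Symmetric R → ∀ {x xs} → AllPairs R xs → x ∈ xs → All (R x) xs
  AllPairs⇒All-∈ refl′ sym (Rx ∷ _) (here refl) = refl′ ∷ Rx
  AllPairs⇒All-∈ refl′ sym (Rx ∷ Rxs) (there x∈xs) =
    sym (All.lookup Rx x∈xs) ∷ AllPairs⇒All-∈ refl′ sym Rxs x∈xs

module _ {A B C : Set} {R : Rel A 0ℓ} {S : Rel B 0ℓ} {T : Rel C 0ℓ} (f : A → B → C)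
         (f-resp : ∀ {x x′ y y′} → R x x′ → S y y′ → T (f x y) (f x′ y′)) where

  AllPairs-zipWith⁺ : ∀ {xs ys} → AllPairs R xs → AllPairs S ys → AllPairs T (zipWith f xs ys)
  AllPairs-zipWith⁺ [] _ = []
  AllPairs-zipWith⁺ (_ ∷ _) [] = []
  AllPairs-zipWith⁺ (Rx ∷ Rxs) (Sy ∷ Sys) = All-zipWith⁺ Rx Sy ∷ AllPairs-zipWith⁺ Rxs Sys
    where
    All-zipWith⁺ : ∀ {x y xs ys} → All (R x) xs → All (S y) ys → All (T (f x y)) (zipWith f xs ys)
    All-zipWith⁺ [] _ = []
    All-zipWith⁺ (_ ∷ _) [] = []
    All-zipWith⁺ (r ∷ rs) (s ∷ ss) = f-resp r s ∷ All-zipWith⁺ rs ss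

mapMaybe-mapMaybe : ∀ {A B C : Set} (g : B → Maybe C) (f : A → Maybe B) xs →
  mapMaybe g (mapMaybe f xs) ≡ mapMaybe (λ x → f x >>= g) xs
mapMaybe-mapMaybe g f [] = refl
mapMaybe-mapMaybe g f (x ∷ xs) with f x
... | nothing = mapMaybe-mapMaybe g f xs
... | just y with g y
...   | nothing = mapMaybe-mapMaybe g f xs
...   | just z = cong (z ∷_) (mapMaybe-mapMaybe g f xs)

Near : ℕ → Rel ℕ 0ℓ
Near M x y = x ≤ y + M × y ≤ x + M

near-refl : ∀ {M} → Reflexive (Near M)
near-refl {M} {x} = m≤m+n x M , m≤m+n x M

near-sym : ∀ {M} → Symmetric (Near M)
near-sym = swap

bounded⇒near : ∀ {M x y} → x ≤ M → y ≤ M → Near M x y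
bounded⇒near {M} {x} {y} x≤M y≤M = ≤-trans x≤M (m≤n+m M y) , ≤-trans y≤M (m≤n+m M x)

near-+ : ∀ {M x x′ y y′} → x′ ≤ x → y ≤ y′ → Near M x x′ → Near M y y′ → Near M (x + y) (x′ + y′)
near-+ {M} {x} {x′} {y} {y′} x′≤x y≤y′ (x≤x′+M , _) (_ , y′≤y+M) =
  ≤-trans (+-mono-≤ x≤x′+M y≤y′) (≤-reflexive (xy∙z≈xz∙y x′ M y′)) ,
  ≤-trans (+-mono-≤ x′≤x y′≤y+M) (≤-reflexive (sym (+-assoc x y M)))

module _ {t : SP} where

  len≤Cmax : (Ps : List (Path t)) → All (λ p → len p ≤ Cmax Ps) Ps
  len≤Cmax Ps = All.map⁻ (foldr-forcesᵇ split 0 (map len Ps) ≤-refl)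
    where
    split : ∀ m n → m ⊔ n ≤ Cmax Ps → m ≤ Cmax Ps × n ≤ Cmax Ps
    split m n m⊔n≤ = m⊔n≤o⇒m≤o m n m⊔n≤ , m⊔n≤o⇒n≤o m n m⊔n≤

  Cmax≤⇒All : ∀ {B} {Ps : List (Path t)} → Cmax Ps ≤ B → All (λ p → len p ≤ B) Ps
  Cmax≤⇒All {Ps = Ps} Cmax≤B = All.map (λ len≤ → ≤-trans len≤ Cmax≤B) (len≤Cmax Ps)

  All⇒Cmax≤ : ∀ {B} {Ps : List (Path t)} → All (λ p → len p ≤ B) Ps → Cmax Ps ≤ B
  All⇒Cmax≤ {B} bounded = foldr-preservesᵇ {P = _≤ B} ⊔-lub z≤n (All.map⁺ bounded)

  θ≤length* : ∀ {B} {Ps : List (Path t)} → All (λ p → len p ≤ B) Ps → θ Ps ≤ length Ps * B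
  θ≤length* [] = z≤n
  θ≤length* (len≤B ∷ bounded) = +-mono-≤ len≤B (θ≤length* bounded)

  θ-↭ : {Ps Qs : List (Path t)} → Ps ↭ Qs → θ Ps ≡ θ Qs
  θ-↭ Ps↭Qs = sum-↭ (↭.map⁺ len Ps↭Qs)

  bounded⇒AllPairs-near : ∀ {M} {Ps : List (Path t)} →
    All (λ p → len p ≤ M) Ps → AllPairs (Near M on len) Ps
  bounded⇒AllPairs-near [] = []
  bounded⇒AllPairs-near (len≤M ∷ bounded) =
    All.map (bounded⇒near len≤M) bounded ∷ bounded⇒AllPairs-near bounded

  len≤mean+spread : ∀ {C M} {Ps : List (Path t)} →
    θ Ps ≤ length Ps * C → AllPairs (Near M on len) Ps → All (λ p → len p ≤ C + M) Ps
  len≤mean+spread {Ps = []} _ _ = []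
  len≤mean+spread {C} {M} {Ps@(_ ∷ _)} θ≤ near = All.tabulate λ {p} p∈Ps →
    *-cancelˡ-≤ (length Ps) (begin
      length Ps * len p              ≤⟨ summed (AllPairs⇒All-∈ near-refl near-sym near p∈Ps) ⟩
      θ Ps + length Ps * M           ≤⟨ +-monoˡ-≤ (length Ps * M) θ≤ ⟩
      length Ps * C + length Ps * M  ≡⟨ *-distribˡ-+ (length Ps) C M ⟨
      length Ps * (C + M)            ∎)
    where
    open ≤-Reasoning
    summed : ∀ {c} {Qs : List (Path t)} →
      All (λ q → Near M c (len q)) Qs → length Qs * c ≤ θ Qs + length Qs * M
    summed [] = z≤n
    summed {c} {q ∷ Qs} ((c≤q+M , _) ∷ near) =
      ≤-trans (+-mono-≤ c≤q+M (summed near)) (≤-reflexive (interchange (len q) M (θ Qs) (length Qs * M)))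

Disjoint-sym : ∀ {t} (p q : Path t) → Disjoint p q → Disjoint q p
Disjoint-sym take take ()
Disjoint-sym (seq p q) (seq p′ q′) (p#p′ , q#q′) = Disjoint-sym p p′ p#p′ , Disjoint-sym q q′ q#q′
Disjoint-sym (left p) (left p′) p#p′ = Disjoint-sym p p′ p#p′
Disjoint-sym (left _) (right _) _ = tt
Disjoint-sym (right _) (left _) _ = tt
Disjoint-sym (right q) (right q′) q#q′ = Disjoint-sym q q′ q#q′

module _ {t : SP} where
  private
    byLength : DecTotalOrder 0ℓ 0ℓ 0ℓ
    byLength = On.decTotalOrder ≤-decTotalOrder (len {t})

  open import Data.List.Sort.InsertionSort.Base byLength using (insert; sort)
  import Data.List.Sort.InsertionSort.Properties byLength as InsertionSort

  insertBy≡insert : ∀ (p : Path t) ps → insertBy p ps ≡ insert p ps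
  insertBy≡insert p [] = refl
  insertBy≡insert p (q ∷ ps) rewrite insertBy≡insert p ps = refl

  sortAsc≡sort : (ps : List (Path t)) → sortAsc ps ≡ sort ps
  sortAsc≡sort [] = refl
  sortAsc≡sort (p ∷ ps) rewrite sortAsc≡sort ps = insertBy≡insert p (sort ps)

  sortAsc-↭ : (ps : List (Path t)) → sortAsc ps ↭ ps
  sortAsc-↭ ps rewrite sortAsc≡sort ps = InsertionSort.sort-↭ ps

  sortAsc-↗ : (ps : List (Path t)) → AllPairs (_≤_ on len) (sortAsc ps)
  sortAsc-↗ ps rewrite sortAsc≡sort ps =
    Sorted⇒AllPairs (DecTotalOrder.totalOrder byLength) (InsertionSort.sort-↗ ps)

  reverse-sortAsc-↭ : (ps : List (Path t)) → reverse (sortAsc ps) ↭ ps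
  reverse-sortAsc-↭ ps = ↭-trans (↭.↭-reverse (sortAsc ps)) (sortAsc-↭ ps)

  AllPairs-sortAsc : ∀ {R : Rel (Path t) 0ℓ} → Symmetric R →
    ∀ {ps} → AllPairs R ps → AllPairs R (sortAsc ps)
  AllPairs-sortAsc sym {ps} = AllPairs-resp-↭ sym (↭-sym (sortAsc-↭ ps))

module _ {l r : SP} where

  θ-zipWith-seq : (xs : List (Path l)) (ys : List (Path r)) → length xs ≡ length ys →
    θ (zipWith seq xs ys) ≡ θ xs + θ ys
  θ-zipWith-seq [] [] _ = refl
  θ-zipWith-seq (x ∷ xs) (y ∷ ys) #≡ = begin
    (len x + len y) + θ (zipWith seq xs ys)
      ≡⟨ cong (len x + len y +_) (θ-zipWith-seq xs ys (suc-injective #≡)) ⟩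
    (len x + len y) + (θ xs + θ ys)
      ≡⟨ interchange (len x) (len y) (θ xs) (θ ys) ⟩
    (len x + θ xs) + (len y + θ ys)
      ∎
    where open ≡-Reasoning

  length-greedyS : (xs : List (Path l)) (ys : List (Path r)) → length xs ≡ length ys →
    length (greedyS xs ys) ≡ length xs
  length-greedyS xs ys #≡ = begin
    length (greedyS xs ys)
      ≡⟨ length-zipWith seq (reverse (sortAsc xs)) (sortAsc ys) ⟩
    length (reverse (sortAsc xs)) ⊓ length (sortAsc ys)
      ≡⟨ cong₂ _⊓_ (↭.↭-length (reverse-sortAsc-↭ xs)) (↭.↭-length (sortAsc-↭ ys)) ⟩
    length xs ⊓ length ys
      ≡⟨ cong (length xs ⊓_) (sym #≡) ⟩
    length xs ⊓ length xs
      ≡⟨ ⊓-idem (length xs) ⟩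
    length xs
      ∎
    where open ≡-Reasoning

  θ-greedyS : (xs : List (Path l)) (ys : List (Path r)) → length xs ≡ length ys →
    θ (greedyS xs ys) ≡ θ xs + θ ys
  θ-greedyS xs ys #≡ = begin
    θ (greedyS xs ys)
      ≡⟨ θ-zipWith-seq (reverse (sortAsc xs)) (sortAsc ys) #sorted≡ ⟩
    θ (reverse (sortAsc xs)) + θ (sortAsc ys)
      ≡⟨ cong₂ _+_ (θ-↭ (reverse-sortAsc-↭ xs)) (θ-↭ (sortAsc-↭ ys)) ⟩
    θ xs + θ ys
      ∎
    where
    open ≡-Reasoning
    #sorted≡ : length (reverse (sortAsc xs)) ≡ length (sortAsc ys)
    #sorted≡ = trans (↭.↭-length (reverse-sortAsc-↭ xs)) (trans #≡ (sym (↭.↭-length (sortAsc-↭ ys))))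

  greedyS-profile : ∀ {xs : List (Path l)} {ys : List (Path r)} →
    IsProfile xs → IsProfile ys → IsProfile (greedyS xs ys)
  greedyS-profile disjoint-xs disjoint-ys =
    AllPairs-zipWith⁺ seq _,_
      (AllPairs-reverse⁺ (AllPairs.map (λ {p} {q} → Disjoint-sym p q)
        (AllPairs-sortAsc (λ {p} {q} → Disjoint-sym p q) disjoint-xs)))
      (AllPairs-sortAsc (λ {p} {q} → Disjoint-sym p q) disjoint-ys)

  greedyS-near : ∀ {M} {xs : List (Path l)} {ys : List (Path r)} →
    AllPairs (Near M on len) xs → AllPairs (Near M on len) ys → AllPairs (Near M on len) (greedyS xs ys)
  greedyS-near {xs = xs} {ys} near-xs near-ys =
    AllPairs-zipWith⁺ seq (λ (near-x , x′≤x) (near-y , y≤y′) → near-+ x′≤x y≤y′ near-x near-y)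
      (AllPairs-reverse⁺ (AllPairs.map (map₁ near-sym)
        (AllPairs.zip (AllPairs-sortAsc near-sym near-xs , sortAsc-↗ xs))))
      (AllPairs.zip (AllPairs-sortAsc near-sym near-ys , sortAsc-↗ ys))

module _ {l r : SP} where

  length-unionP : (xs : List (Path l)) (ys : List (Path r)) → length (unionP xs ys) ≡ length xs + length ys
  length-unionP xs ys =
    trans (length-++ (map left xs)) (cong₂ _+_ (length-map left xs) (length-map right ys))

  θ-unionP : (xs : List (Path l)) (ys : List (Path r)) → θ (unionP xs ys) ≡ θ xs + θ ys
  θ-unionP xs ys = begin
    sum (map len (map left xs ++ map right ys))
      ≡⟨ cong sum (map-++ len (map left xs) (map right ys)) ⟩
    sum (map len (map left xs) ++ map len (map right ys))
      ≡⟨ sum-++ (map len (map left xs)) (map len (map right ys)) ⟩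
    θ (map left xs) + θ (map right ys)
      ≡⟨ cong₂ _+_ (cong sum (sym (map-∘ xs))) (cong sum (sym (map-∘ ys))) ⟩
    θ xs + θ ys
      ∎
    where open ≡-Reasoning

  unionP-profile : ∀ {xs : List (Path l)} {ys : List (Path r)} →
    IsProfile xs → IsProfile ys → IsProfile (unionP xs ys)
  unionP-profile {xs} {ys} disjoint-xs disjoint-ys =
    AllPairs.++⁺ (AllPairs.map⁺ disjoint-xs) (AllPairs.map⁺ disjoint-ys)
      (All.map⁺ (All.universal (λ _ → All.map⁺ (All.universal (λ _ → tt) ys)) xs))

  unionP-bounded : ∀ {B} {xs : List (Path l)} {ys : List (Path r)} →
    All (λ p → len p ≤ B) xs → All (λ p → len p ≤ B) ys → All (λ p → len p ≤ B) (unionP xs ys)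
  unionP-bounded bounded-xs bounded-ys = All.++⁺ (All.map⁺ bounded-xs) (All.map⁺ bounded-ys)

zipWith-seq-fstS-sndS : ∀ {l r} (Rs : List (Path (S l r))) → zipWith seq (map fstS Rs) (map sndS Rs) ≡ Rs
zipWith-seq-fstS-sndS [] = refl
zipWith-seq-fstS-sndS (seq a b ∷ Rs) = cong (seq a b ∷_) (zipWith-seq-fstS-sndS Rs)

unionP-fstP-sndP-↭ : ∀ {l r} (Rs : List (Path (P l r))) →
  unionP (mapMaybe fstP Rs) (mapMaybe sndP Rs) ↭ Rs
unionP-fstP-sndP-↭ [] = ↭-refl
unionP-fstP-sndP-↭ (left a ∷ Rs) = prep (left a) (unionP-fstP-sndP-↭ Rs)
unionP-fstP-sndP-↭ (right b ∷ Rs) =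
  ↭-trans (↭.shift (right b) (map left (mapMaybe fstP Rs)) (map right (mapMaybe sndP Rs)))
          (prep (right b) (unionP-fstP-sndP-↭ Rs))

restrict-shortens : ∀ {D t} (q : Pos D t) (p : Path D) →
  Maybe.All (λ p′ → len p′ ≤ len p) (restrict q p)
restrict-shortens root p = Maybe.just ≤-refl
restrict-shortens (sL q) p with restrict q p | restrict-shortens q p
... | just (seq a b) | Maybe.just a+b≤ = Maybe.just (≤-trans (m≤m+n (len a) (len b)) a+b≤)
... | nothing | Maybe.nothing = Maybe.nothing
restrict-shortens (sR q) p with restrict q p | restrict-shortens q p
... | just (seq a b) | Maybe.just a+b≤ = Maybe.just (≤-trans (m≤n+m (len b) (len a)) a+b≤)
... | nothing | Maybe.nothing = Maybe.nothing
restrict-shortens (pL q) p with restrict q p | restrict-shortens q p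
... | just (left a) | Maybe.just a≤ = Maybe.just a≤
... | just (right _) | _ = Maybe.nothing
... | nothing | Maybe.nothing = Maybe.nothing
restrict-shortens (pR q) p with restrict q p | restrict-shortens q p
... | just (left _) | _ = Maybe.nothing
... | just (right b) | Maybe.just b≤ = Maybe.just b≤
... | nothing | Maybe.nothing = Maybe.nothing

module _ {D : SP} (Ps : List (Path D)) where

  restrictProfile-bounded : ∀ {t} (q : Pos D t) → All (λ p → len p ≤ Cmax Ps) (restrictProfile q Ps)
  restrictProfile-bounded q = All.mapMaybe⁺ (All.map⁺ (All.map shortened (len≤Cmax Ps)))
    where
    shortened : ∀ {p} → len p ≤ Cmax Ps → Maybe.All (λ p′ → len p′ ≤ Cmax Ps) (restrict q p)
    shortened {p} len≤ = Maybe.map (λ len′≤ → ≤-trans len′≤ len≤) (restrict-shortens q p)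

  module _ {l r} (q : Pos D (S l r)) where

    restrictProfile-sL : restrictProfile (sL q) Ps ≡ map fstS (restrictProfile q Ps)
    restrictProfile-sL = sym (map-mapMaybe fstS (restrict q) Ps)

    restrictProfile-sR : restrictProfile (sR q) Ps ≡ map sndS (restrictProfile q Ps)
    restrictProfile-sR = sym (map-mapMaybe sndS (restrict q) Ps)

    length-restrictProfile-sL : length (restrictProfile (sL q) Ps) ≡ length (restrictProfile q Ps)
    length-restrictProfile-sL = trans (cong length restrictProfile-sL) (length-map fstS (restrictProfile q Ps))

    length-restrictProfile-sR : length (restrictProfile (sR q) Ps) ≡ length (restrictProfile q Ps)
    length-restrictProfile-sR = trans (cong length restrictProfile-sR) (length-map sndS (restrictProfile q Ps))

    θ-restrictProfile-S :
      θ (restrictProfile (sL q) Ps) + θ (restrictProfile (sR q) Ps) ≡ θ (restrictProfile q Ps)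
    θ-restrictProfile-S = begin
      θ (restrictProfile (sL q) Ps) + θ (restrictProfile (sR q) Ps)
        ≡⟨ cong₂ _+_ (cong θ restrictProfile-sL) (cong θ restrictProfile-sR) ⟩
      θ (map fstS Rs) + θ (map sndS Rs)
        ≡⟨ θ-zipWith-seq (map fstS Rs) (map sndS Rs) #≡ ⟨
      θ (zipWith seq (map fstS Rs) (map sndS Rs))
        ≡⟨ cong θ (zipWith-seq-fstS-sndS Rs) ⟩
      θ Rs
        ∎
      where
      open ≡-Reasoning
      Rs = restrictProfile q Ps
      #≡ : length (map fstS Rs) ≡ length (map sndS Rs)
      #≡ = trans (length-map fstS Rs) (sym (length-map sndS Rs))

  module _ {l r} (q : Pos D (P l r)) where

    restrictProfile-pL : restrictProfile (pL q) Ps ≡ mapMaybe fstP (restrictProfile q Ps)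
    restrictProfile-pL = sym (mapMaybe-mapMaybe fstP (restrict q) Ps)

    restrictProfile-pR : restrictProfile (pR q) Ps ≡ mapMaybe sndP (restrictProfile q Ps)
    restrictProfile-pR = sym (mapMaybe-mapMaybe sndP (restrict q) Ps)

    unionP-restrictProfile-↭ :
      unionP (restrictProfile (pL q) Ps) (restrictProfile (pR q) Ps) ↭ restrictProfile q Ps
    unionP-restrictProfile-↭ rewrite restrictProfile-pL | restrictProfile-pR =
      unionP-fstP-sndP-↭ (restrictProfile q Ps)

    length-restrictProfile-P :
      length (restrictProfile (pL q) Ps) + length (restrictProfile (pR q) Ps) ≡ length (restrictProfile q Ps)
    length-restrictProfile-P =
      trans (sym (length-unionP (restrictProfile (pL q) Ps) (restrictProfile (pR q) Ps)))
            (↭.↭-length unionP-restrictProfile-↭)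

    θ-restrictProfile-P :
      θ (restrictProfile (pL q) Ps) + θ (restrictProfile (pR q) Ps) ≡ θ (restrictProfile q Ps)
    θ-restrictProfile-P =
      trans (sym (θ-unionP (restrictProfile (pL q) Ps) (restrictProfile (pR q) Ps)))
            (θ-↭ unionP-restrictProfile-↭)

module _ {D : SP} (Pstar : List (Path D)) where

  consistent⇒θ≤ : ∀ {t} (q : Pos D t) Qs → Consistent Pstar q Qs → θ Qs ≤ length Qs * Cmax Pstar
  consistent⇒θ≤ q Qs (#≡ , θ≤) = begin
    θ Qs                                                 ≤⟨ θ≤ ⟩
    θ (restrictProfile q Pstar)                          ≤⟨ θ≤length* (restrictProfile-bounded Pstar q) ⟩
    length (restrictProfile q Pstar) * Cmax Pstar        ≡⟨ cong (_* Cmax Pstar) #≡ ⟨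
    length Qs * Cmax Pstar                               ∎
    where open ≤-Reasoning

  greedyS-consistent : ∀ {l r} (q : Pos D (S l r)) xs ys →
    Consistent Pstar (sL q) xs → Consistent Pstar (sR q) ys → Consistent Pstar q (greedyS xs ys)
  greedyS-consistent q xs ys (#xs , θxs) (#ys , θys) = #greedy , θgreedy
    where
    #xs≡ : length xs ≡ length (restrictProfile q Pstar)
    #xs≡ = trans #xs (length-restrictProfile-sL Pstar q)
    #ys≡ : length ys ≡ length (restrictProfile q Pstar)
    #ys≡ = trans #ys (length-restrictProfile-sR Pstar q)
    #xs≡#ys : length xs ≡ length ys
    #xs≡#ys = trans #xs≡ (sym #ys≡)
    #greedy : length (greedyS xs ys) ≡ length (restrictProfile q Pstar)
    #greedy = trans (length-greedyS xs ys #xs≡#ys) #xs≡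
    θgreedy : θ (greedyS xs ys) ≤ θ (restrictProfile q Pstar)
    θgreedy = begin
      θ (greedyS xs ys)                                                   ≡⟨ θ-greedyS xs ys #xs≡#ys ⟩
      θ xs + θ ys                                                         ≤⟨ +-mono-≤ θxs θys ⟩
      θ (restrictProfile (sL q) Pstar) + θ (restrictProfile (sR q) Pstar) ≡⟨ θ-restrictProfile-S Pstar q ⟩
      θ (restrictProfile q Pstar)                                         ∎
      where open ≤-Reasoning

  unionP-consistent : ∀ {l r} (q : Pos D (P l r)) xs ys →
    Consistent Pstar (pL q) xs → Consistent Pstar (pR q) ys → Consistent Pstar q (unionP xs ys)
  unionP-consistent q xs ys (#xs , θxs) (#ys , θys) =
    trans (length-unionP xs ys) (trans (cong₂ _+_ #xs #ys) (length-restrictProfile-P Pstar q)) ,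
    (begin
      θ (unionP xs ys)                                                    ≡⟨ θ-unionP xs ys ⟩
      θ xs + θ ys                                                         ≤⟨ +-mono-≤ θxs θys ⟩
      θ (restrictProfile (pL q) Pstar) + θ (restrictProfile (pR q) Pstar) ≡⟨ θ-restrictProfile-P Pstar q ⟩
      θ (restrictProfile q Pstar)                                         ∎)
    where open ≤-Reasoning

φ-SBelow : ∀ {D l r u} {q : Pos D (S l r)} {c : Pos D u} → SBelow q c → φ' true u ≤ φ' true (S l r)
φ-SBelow here = ≤-refl
φ-SBelow {c = sL {l′} {r′} _} (goL below) = ≤-trans (m≤m⊔n (φ' true l′) (φ' true r′)) (φ-SBelow below)
φ-SBelow {c = sR {l′} {r′} _} (goR below) = ≤-trans (m≤n⊔m (φ' true l′) (φ' true r′)) (φ-SBelow below)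

φ-PBelow : ∀ {D l r u} {q : Pos D (P l r)} {c : Pos D u} → PBelow q c → φ u ≤ φ (P l r)
φ-PBelow here = ≤-refl
φ-PBelow {c = pL {l′} {r′} _} (goL below) = ≤-trans (m≤m⊔n (φ l′) (φ r′)) (φ-PBelow below)
φ-PBelow {c = pR {l′} {r′} _} (goR below) = ≤-trans (m≤n⊔m (φ l′) (φ r′)) (φ-PBelow below)

module _ {D : SP} (Pstar : List (Path D)) (F : ∀ {u} → Pos D u → List (Path u)) where

  private
    C : ℕ
    C = Cmax Pstar

  gSer-good : ∀ {l r} (q : Pos D (S l r)) → (∀ {u} (c : Pos D u) → SChild q c → Good Pstar c (F c)) →
    Good Pstar q (gSer F q)
  gSer-good {l} {r} q children-good =
    let profile , consistent , near = invariant q here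
        bounded = len≤mean+spread {C = C} {M = M} (consistent⇒θ≤ Pstar q (gSer F q) consistent) near
    in profile , consistent , All⇒Cmax≤ (subst (λ B → All (λ p → len p ≤ B) (gSer F q)) C+M≡ bounded)
    where
    M : ℕ
    M = φ (S l r) * C

    C+M≡ : C + M ≡ (φ (S l r) + 1) * C
    C+M≡ = cong (_* C) (+-comm 1 (φ (S l r)))

    Invariant : ∀ {u} → Pos D u → List (Path u) → Set
    Invariant c Qs = IsProfile Qs × Consistent Pstar c Qs × AllPairs (Near M on len) Qs

    -- A child u is not labelled S, so φ u is φ' true u, while φ (S l r) = 1 + φ' true (S l r).
    child-invariant : ∀ {u} (c : Pos D u) → SChild q c → φ u ≤ φ' true (S l r) → Invariant c (F c)
    child-invariant {u} c child φ≤ =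
      let profile , consistent , Cmax≤ = children-good c child
          φ+1≤ = subst (_≤ φ (S l r)) (+-comm 1 (φ u)) (s≤s φ≤)
          bounded = Cmax≤⇒All (≤-trans Cmax≤ (*-monoˡ-≤ C φ+1≤))
      in profile , consistent , bounded⇒AllPairs-near bounded

    invariant : ∀ {u} (c : Pos D u) → SBelow q c → Invariant c (gSer F c)
    invariant {leaf _} c below = child-invariant c (below , tt) (φ-SBelow below)
    invariant {P _ _} c below = child-invariant c (below , tt) (φ-SBelow below)
    invariant {S _ _} c below =
      let profileˡ , consistentˡ , nearˡ = invariant (sL c) (goL below)
          profileʳ , consistentʳ , nearʳ = invariant (sR c) (goR below)
      in greedyS-profile profileˡ profileʳ ,
         greedyS-consistent Pstar c (gSer F (sL c)) (gSer F (sR c)) consistentˡ consistentʳ ,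
         greedyS-near nearˡ nearʳ

  gPar-good : ∀ {l r} (q : Pos D (P l r)) → (∀ {u} (c : Pos D u) → PChild q c → Good Pstar c (F c)) →
    Good Pstar q (gPar F q)
  gPar-good {l} {r} q children-good =
    let profile , consistent , bounded = invariant q here
    in profile , consistent , All⇒Cmax≤ bounded
    where
    B : ℕ
    B = (φ (P l r) + 1) * C

    Invariant : ∀ {u} → Pos D u → List (Path u) → Set
    Invariant c Qs = IsProfile Qs × Consistent Pstar c Qs × All (λ p → len p ≤ B) Qs

    child-invariant : ∀ {u} (c : Pos D u) → PChild q c → Invariant c (F c)
    child-invariant c child@(below , _) =
      let profile , consistent , Cmax≤ = children-good c child
          φ+1≤ = +-monoˡ-≤ 1 (φ-PBelow below)
      in profile , consistent , Cmax≤⇒All (≤-trans Cmax≤ (*-monoˡ-≤ C φ+1≤))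

    invariant : ∀ {u} (c : Pos D u) → PBelow q c → Invariant c (gPar F c)
    invariant {leaf _} c below = child-invariant c (below , tt)
    invariant {S _ _} c below = child-invariant c (below , tt)
    invariant {P _ _} c below =
      let profileˡ , consistentˡ , boundedˡ = invariant (pL c) (goL below)
          profileʳ , consistentʳ , boundedʳ = invariant (pR c) (goR below)
      in unionP-profile profileˡ profileʳ ,
         unionP-consistent Pstar c (gPar F (pL c)) (gPar F (pR c)) consistentˡ consistentʳ ,
         unionP-bounded boundedˡ boundedʳ

S-component-good : ∀ {D} (Pstar : List (Path D)) (F : ∀ {u} → Pos D u → List (Path u)) →
  ∀ {t} (q : Pos D t) → SRoot q →
  (∀ {u} (c : Pos D u) → SChild q c → Good Pstar c (F c)) → Good Pstar q (gSer F q)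
S-component-good Pstar F _ (sroot-root refl) = gSer-good Pstar F root
S-component-good Pstar F _ (sroot-pL q) = gSer-good Pstar F (pL q)
S-component-good Pstar F _ (sroot-pR q) = gSer-good Pstar F (pR q)

P-component-good : ∀ {D} (Pstar : List (Path D)) (F : ∀ {u} → Pos D u → List (Path u)) →
  ∀ {t} (q : Pos D t) → PRoot q →
  (∀ {u} (c : Pos D u) → PChild q c → Good Pstar c (F c)) → Good Pstar q (gPar F q)
P-component-good Pstar F _ (proot-root refl) = gPar-good Pstar F root
P-component-good Pstar F _ (proot-sL q) = gPar-good Pstar F (sL q)
P-component-good Pstar F _ (proot-sR q) = gPar-good Pstar F (sR q)

lemma11 : (D : SP) (k : ℕ) (Pstar : List (Path D)) → Optimal D k Pstar →
    (F : ∀ {u} → Pos D u → List (Path u)) →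
    (∀ {t} (q : Pos D t) → SRoot q →
      (∀ {u} (c : Pos D u) → SChild q c → Good Pstar c (F c)) →
      Good Pstar q (gSer F q))
    × (∀ {t} (q : Pos D t) → PRoot q →
      (∀ {u} (c : Pos D u) → PChild q c → Good Pstar c (F c)) →
      Good Pstar q (gPar F q))
lemma11 D k Pstar _ F = S-component-good Pstar F , P-component-good Pstar F
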